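{- For every value $v$, heap $h$, ground type $\tau$ and $w$: if $v\models^h_\tau w$ then $v\models^{h|_{R(h,v)}}_\tau w$.
   Context: Values are $v::=c\mid\ell\mid\mathtt{NULL}$ ($c$ an integer, $\ell$ a location). A heap is a finite partial map from locations to partial maps $\{\mathtt{hd},\mathtt{tl}\}\rightharpoonup$ values; $h.\ell.\mathtt{hd}$, $h.\ell.\mathtt{tl}$ are the stored values, $h|_X$ is restriction of $h$ to a set $X$ of locations, $h\setminus\ell$ is $h$ with $\ell$ removed from its domain. The footprint: $R(h,c)=R(h,\mathtt{NULL})=\emptyset$, $R(h,\ell)=\emptyset$ if $\ell\notin\mathrm{dom}\,h$, otherwise $R(h,\ell)=\{\ell\}\cup R(h\setminus\ell,h.\ell.\mathtt{hd})\cup R(h\setminus\ell,h.\ell.\mathtt{tl})$. Ground types: $\tau::=\mathtt{Int}\mid[\tau]^{n}$ with $n$ a natural number. The relation $v\models^h_\tau w$ is defined by: $c\models^h_{\mathtt{Int}}c$; $\mathtt{NULL}\models^h_{[\tau]^0}[\,]$; $\ell\models^h_{[\tau]^n}w_{hd}::w_{tl}$ iff $n\ge1$, $\ell\in\mathrm{dom}\,h$, $h.\ell.\mathtt{hd}\models^{h\setminus\ell}_{\tau}w_{hd}$ and $h.\ell.\mathtt{tl}\models^{h\setminus\ell}_{[\tau]^{n-1}}w_{tl}$; nothing else holds. -}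

module Defs where

open import Data.Nat using (ℕ; zero; suc; _≟_)
open import Data.Integer using (ℤ)
open import Data.Maybe using (Maybe; just; nothing)
open import Data.Product using (_×_; _,_; proj₁)
open import Data.List using (List; []; _∷_; _++_; filter; length)
open import Data.List.Membership.DecPropositional _≟_ using (_∈?_)
open import Relation.Nullary using (yes; no; ¬?)
open import Relation.Binary.PropositionalEquality using (_≡_)

Loc : Set
Loc = ℕ

data Val : Set where
  int  : ℤ → Val
  loc  : Loc → Val
  null : Val

record Cell : Set where
  constructor cell
  field
    hd : Maybe Val
    tl : Maybe Val
open Cell public

-- A heap: finite partial map Loc ⇀ Cell, represented as an association list;
-- the entry for a location is the first one in the list.
Heap : Set
Heap = List (Loc × Cell)

lookup : Heap → Loc → Maybe Cell
lookup [] ℓ = nothing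
lookup ((k , c) ∷ h) ℓ with k ≟ ℓ
... | yes _ = just c
... | no  _ = lookup h ℓ

_∖_ : Heap → Loc → Heap
h ∖ ℓ = filter (λ e → ¬? (proj₁ e ≟ ℓ)) h

LocSet : Set
LocSet = List Loc

_∣_ : Heap → LocSet → Heap
h ∣ X = filter (λ e → proj₁ e ∈? X) h

-- Footprint R(h, v), computed with fuel; the fuel (length h) is always
-- sufficient since each recursive call removes a location of dom h.
-- An undefined field (nothing) contributes the empty set.
mutual
  Rf : ℕ → Heap → Val → LocSet
  Rf _ h (int _) = []
  Rf _ h null = []
  Rf zero h (loc ℓ) = []
  Rf (suc n) h (loc ℓ) with lookup h ℓ
  ... | nothing = []
  ... | just c  = ℓ ∷ (Rm n (h ∖ ℓ) (hd c) ++ Rm n (h ∖ ℓ) (tl c))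

  Rm : ℕ → Heap → Maybe Val → LocSet
  Rm n h nothing  = []
  Rm n h (just v) = Rf n h v

R : Heap → Val → LocSet
R h v = Rf (length h) h v

data Ty : Set where
  Int  : Ty
  Lst : Ty → ℕ → Ty

data W : Set where
  wint  : ℤ → W
  wnil  : W
  wcons : W → W → W

data Sat : Heap → Val → Ty → W → Set where
  sat-int  : ∀ {h c} → Sat h (int c) Int (wint c)
  sat-nil  : ∀ {h τ} → Sat h null (Lst τ 0) wnil
  sat-cons : ∀ {h ℓ c vh vt τ n wh wt} →
             lookup h ℓ ≡ just c →
             hd c ≡ just vh →
             tl c ≡ just vt →
             Sat (h ∖ ℓ) vh τ wh →
             Sat (h ∖ ℓ) vt (Lst τ n) wt →
             Sat h (loc ℓ) (Lst τ (suc n)) (wcons wh wt)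

module Submission where

-- The footprint R h v = Rf (length h) h v is computed with fuel, so we prove
-- the stronger, fuel-parametric statement `Sat-restrict`: if v ⊨^h_τ w, the
-- fuel n is at least the size of h, and X is any set of locations containing
-- Rf n h v, then v ⊨^{h|X}_τ w.

open import Defs
open import Data.Nat using (ℕ; zero; suc; _≤_; _<_; _≟_)
open import Data.Nat.Properties using (≤-refl; ≤-pred; ≤-trans; <-≤-trans; n≮0)
open import Data.Bool using (true; false)
open import Data.Maybe using (just)
open import Data.Product using (_,_; proj₁)
open import Data.List using (List; []; _∷_; _++_; filter; length)
open import Data.List.Properties using (filter-notAll)
open import Data.List.Relation.Unary.Any as Any using (Any; here; there)
open import Data.List.Membership.Propositional using (_∈_)
open import Data.List.Membership.Propositional.Properties using (∈-++⁺ˡ; ∈-++⁺ʳ)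
open import Data.List.Relation.Binary.Subset.Propositional using (_⊆_)
open import Data.List.Membership.DecPropositional _≟_ using (_∈?_)
open import Relation.Nullary using (does; yes; no; ¬?)
open import Relation.Unary using (Pred; Decidable)
open import Relation.Binary.PropositionalEquality using (_≡_; refl; sym; trans; cong; subst)
open import Data.Empty using (⊥-elim)
open import Function using (_∘_)

filter-comm : ∀ {a ℓp ℓq} {A : Set a} {P : Pred A ℓp} {Q : Pred A ℓq}
              (P? : Decidable P) (Q? : Decidable Q) (xs : List A) →
              filter P? (filter Q? xs) ≡ filter Q? (filter P? xs)
filter-comm P? Q? [] = refl
filter-comm P? Q? (x ∷ xs) with does (P? x) in Px | does (Q? x) in Qx
... | true  | true  rewrite Px | Qx = cong (x ∷_) (filter-comm P? Q? xs)
... | true  | false rewrite Qx      = filter-comm P? Q? xs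
... | false | true  rewrite Px      = filter-comm P? Q? xs
... | false | false                = filter-comm P? Q? xs

∖-∣-comm : (h : Heap) (X : LocSet) (ℓ : Loc) → (h ∣ X) ∖ ℓ ≡ (h ∖ ℓ) ∣ X
∖-∣-comm h X ℓ =
  filter-comm (λ e → ¬? (proj₁ e ≟ ℓ)) (λ e → proj₁ e ∈? X) h

lookup-∣ : (h : Heap) (X : LocSet) (ℓ : Loc) → ℓ ∈ X →
           lookup (h ∣ X) ℓ ≡ lookup h ℓ
lookup-∣ [] X ℓ ℓ∈X = refl
lookup-∣ ((k , c) ∷ h) X ℓ ℓ∈X with k ∈? X
... | yes _ with k ≟ ℓ
...   | yes _ = refl
...   | no  _ = lookup-∣ h X ℓ ℓ∈X
lookup-∣ ((k , c) ∷ h) X ℓ ℓ∈X | no k∉X with k ≟ ℓ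
...   | yes refl = ⊥-elim (k∉X ℓ∈X)
...   | no  _    = lookup-∣ h X ℓ ℓ∈X

lookup⇒key : (h : Heap) (ℓ : Loc) {c : Cell} → lookup h ℓ ≡ just c →
             Any (λ e → proj₁ e ≡ ℓ) h
lookup⇒key ((k , _) ∷ h) ℓ eq with k ≟ ℓ
... | yes k≡ℓ = here k≡ℓ
... | no  _   = there (lookup⇒key h ℓ eq)

-- Removing an allocated location strictly shrinks the heap; this is what
-- makes the fuel `length h` sufficient for the footprint computation.
length-∖ : (h : Heap) (ℓ : Loc) {c : Cell} → lookup h ℓ ≡ just c →
           length (h ∖ ℓ) < length h
length-∖ h ℓ eq =
  filter-notAll (λ e → ¬? (proj₁ e ≟ ℓ)) h
    (Any.map (λ k≡ℓ k≢ℓ → k≢ℓ k≡ℓ) (lookup⇒key h ℓ eq))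

Rf-cons : (n : ℕ) (h : Heap) (ℓ : Loc) {c : Cell} {vh vt : Val} →
          lookup h ℓ ≡ just c → hd c ≡ just vh → tl c ≡ just vt →
          Rf (suc n) h (loc ℓ) ≡ ℓ ∷ (Rf n (h ∖ ℓ) vh ++ Rf n (h ∖ ℓ) vt)
Rf-cons n h ℓ eq eh et rewrite eq | eh | et = refl

Sat-restrict : {h : Heap} {v : Val} {τ : Ty} {w : W} (n : ℕ) (X : LocSet) →
               Sat h v τ w → length h ≤ n → Rf n h v ⊆ X → Sat (h ∣ X) v τ w
Sat-restrict n X sat-int _ _ = sat-int
Sat-restrict n X sat-nil _ _ = sat-nil
Sat-restrict {h} zero X (sat-cons {ℓ = ℓ} eq _ _ _ _) h≤0 _ =
  ⊥-elim (n≮0 (<-≤-trans (length-∖ h ℓ eq) h≤0))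
Sat-restrict {h} (suc n) X (sat-cons {ℓ = ℓ} {vh = vh} {vt = vt} eq eh et sh st) h≤n R⊆X =
  sat-cons (trans (lookup-∣ h X ℓ (footprint⊆X (here refl))) eq) eh et
    (subst (λ g → Sat g vh _ _) (sym (∖-∣-comm h X ℓ))
      (Sat-restrict n X sh h∖ℓ≤n (footprint⊆X ∘ there ∘ ∈-++⁺ˡ)))
    (subst (λ g → Sat g vt _ _) (sym (∖-∣-comm h X ℓ))
      (Sat-restrict n X st h∖ℓ≤n (footprint⊆X ∘ there ∘ ∈-++⁺ʳ (Rf n (h ∖ ℓ) vh))))
  where
  footprint⊆X : ℓ ∷ (Rf n (h ∖ ℓ) vh ++ Rf n (h ∖ ℓ) vt) ⊆ X
  footprint⊆X = R⊆X ∘ subst (_ ∈_) (sym (Rf-cons n h ℓ eq eh et))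

  h∖ℓ≤n : length (h ∖ ℓ) ≤ n
  h∖ℓ≤n = ≤-pred (≤-trans (length-∖ h ℓ eq) h≤n)

lemma6p4 : (v : Val) (h : Heap) (τ : Ty) (w : W) →
    Sat h v τ w → Sat (h ∣ R h v) v τ w
lemma6p4 v h τ w sat = Sat-restrict (length h) (R h v) sat ≤-refl (λ x∈R → x∈R)
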